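{- For all integers $\alpha \geq 1$, \[L_{2\alpha} = q f_1 f_2^2 \sum_{n=0}^\infty a_3\left(5^{2\alpha} n + \gamma_{\alpha}\right)q^n,\] where $\gamma_{\alpha} = 20 + \frac{19 \cdot 25 (25^{\alpha-1}-1)}{24}$.
   Context: All functions are treated as formal Laurent series in $q$ (with $q=e^{2\pi i\tau}$). For $r\ge1$, $f_r = \prod_{n\ge1}(1-q^{rn})$. $a_3(n)$ is the number of partitions of $n$ in which odd parts are unrestricted and each even part may independently be given one of $3$ colors, so $\sum_{n\ge0}a_3(n)q^n = 1/(f_1f_2^2)$. The operator $U_5$ acts on Laurent series by $U_5\left(\sum_{n} a(n)q^n\right) = \sum_{n} a(5n)q^n$. Let $\Phi = q^5 \frac{f_{25}f_{50}^2}{f_1f_2^2}$. Define $L_0 = 1$ and for $\alpha\ge 0$, $L_{\alpha+1} = U_5(\Phi\cdot L_\alpha)$ if $\alpha$ is even and $L_{\alpha+1} = U_5(L_\alpha)$ if $\alpha$ is odd. -}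

module Defs where

open import Data.Nat using (ℕ; zero; suc; _+_; _*_; _∸_; _^_; _≤ᵇ_; _/_)
open import Data.Integer as ℤ using (ℤ; +_)
open import Data.Bool using (Bool; true; false; if_then_else_)

-- Formal power series in q with integer coefficients: n ↦ coefficient of q^n.
-- (All series occurring here have only nonnegative powers of q.)
Series : Set
Series = ℕ → ℤ

sumTo : ℕ → (ℕ → ℤ) → ℤ
sumTo zero    g = g 0
sumTo (suc m) g = sumTo m g ℤ.+ g (suc m)

one : Series
one zero    = + 1
one (suc _) = + 0

shift : ℕ → Series → Series
shift k s m = if k ≤ᵇ m then s (m ∸ k) else + 0

_⊛_ : Series → Series → Series
(s ⊛ t) m = sumTo m (λ k → s k ℤ.* t (m ∸ k))

-- multiplication by (1 - q^k)
mulFactor : ℕ → Series → Series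
mulFactor k s m = s m ℤ.- shift k s m

-- division by (1 - q^k), k ≥ 1: multiplication by Σ_j q^{kj}
divFactor : ℕ → Series → Series
divFactor k s m = sumTo m (λ j → if (k * j) ≤ᵇ m then s (m ∸ k * j) else + 0)

prodUpTo : (ℕ → Series → Series) → ℕ → ℕ → Series → Series
prodUpTo op r zero    s = s
prodUpTo op r (suc N) s = op (r * suc N) (prodUpTo op r N s)

-- multiplication by f_r = ∏_{n≥1}(1 - q^{rn}) (r ≥ 1): the coefficient of q^m
-- only depends on the factors with n ≤ m, so the truncation is exact.
fMul : ℕ → Series → Series
fMul r s m = prodUpTo mulFactor r m s m

-- division by f_r (r ≥ 1), exact for the same reason.
fDiv : ℕ → Series → Series
fDiv r s m = prodUpTo divFactor r m s m

-- Σ a_3(n) q^n = 1/(f_1 f_2^2)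
a3 : ℕ → ℤ
a3 = fDiv 1 (fDiv 2 (fDiv 2 one))

Φ : Series
Φ = shift 5 (fMul 25 (fMul 50 (fMul 50 a3)))

U5 : Series → Series
U5 s n = s (5 * n)

isEven : ℕ → Bool
isEven zero    = true
isEven (suc n) = if isEven n then false else true

L : ℕ → Series
L zero    = one
L (suc α) = if isEven α then U5 (Φ ⊛ L α) else U5 (L α)

-- γ_α = 20 + 19·25·(25^{α-1} - 1)/24  (exact division for α ≥ 1)
γ : ℕ → ℕ
γ α = 20 + (19 * 25 * (25 ^ (α ∸ 1) ∸ 1)) / 24

-- Since f₂₅f₅₀² is a series in q⁵, U₅ turns it into f₅f₁₀², and a second U₅ turns that into
-- f₁f₂²; with Φ = q⁵ f₂₅f₅₀² Σ a₃(n)qⁿ this gives L₂ = U₅²Φ = q f₁f₂² Σ a₃(25n + 20)qⁿ.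
-- If L_{2α} = q f₁f₂² S, then Φ L_{2α} = q⁶ f₂₅f₅₀² S because f₁f₂² cancels the denominator of
-- Φ, and the same two applications of U₅ give L_{2α+2} = q f₁f₂² Σ S(25n + 19)qⁿ.
-- The series are manipulated through multipliers, i.e. causal operators F with
-- F(a b) = F(a) b; any two of them commute.

module Submission where

open import Defs
open import Data.Nat using (ℕ; _+_; _*_; _^_; _≤_)
open import Relation.Binary.PropositionalEquality using (_≡_)

open import Data.Nat
  using (zero; suc; _∸_; _<_; _≤′_; ≤′-refl; ≤′-step; z≤n; s≤s; z<s; _≤?_; >-nonZero)
import Data.Nat.Properties as ℕP
open import Data.Nat.DivMod using (_/_; m*n/n≡m)
open import Data.Nat.Induction using (<-rec)
import Data.Nat.Tactic.RingSolver as ℕ-Solver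
open import Data.Integer as ℤ using (ℤ; +_)
import Data.Integer.Properties as ℤP
import Data.Integer.Tactic.RingSolver as ℤ-Solver
open import Data.Bool using (true; false)
open import Relation.Nullary using (yes; no)
open import Relation.Binary.PropositionalEquality
  using (refl; sym; trans; cong; cong₂; subst; _≗_; _→-setoid_; module ≡-Reasoning)
open import Relation.Binary.Bundles using (Setoid)
import Relation.Binary.Reasoning.Setoid as SetoidReasoning

module ≗ = Setoid (ℕ →-setoid ℤ) using (sym; trans)
module ≗-Reasoning = SetoidReasoning (ℕ →-setoid ℤ)

[i+j]-j≡i : ∀ i j → (i ℤ.+ j) ℤ.- j ≡ i
[i+j]-j≡i = ℤ-Solver.solve-∀

[i-j]+j≡i : ∀ i j → (i ℤ.- j) ℤ.+ j ≡ i
[i-j]+j≡i = ℤ-Solver.solve-∀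

[i-j]*k≡i*k-j*k : ∀ i j k → (i ℤ.- j) ℤ.* k ≡ i ℤ.* k ℤ.- j ℤ.* k
[i-j]*k≡i*k-j*k = ℤ-Solver.solve-∀

[i-j]+[k-l]≡[i+k]-[j+l] : ∀ i j k l → (i ℤ.- j) ℤ.+ (k ℤ.- l) ≡ (i ℤ.+ k) ℤ.- (j ℤ.+ l)
[i-j]+[k-l]≡[i+k]-[j+l] = ℤ-Solver.solve-∀

sumTo-cong : ∀ m {f g : ℕ → ℤ} → (∀ k → k ≤ m → f k ≡ g k) → sumTo m f ≡ sumTo m g
sumTo-cong zero    eq = eq 0 z≤n
sumTo-cong (suc m) eq =
  cong₂ ℤ._+_ (sumTo-cong m (λ k k≤m → eq k (ℕP.m≤n⇒m≤1+n k≤m))) (eq (suc m) ℕP.≤-refl)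

sumTo-sucˡ : ∀ m (f : ℕ → ℤ) → sumTo (suc m) f ≡ f 0 ℤ.+ sumTo m (λ k → f (suc k))
sumTo-sucˡ zero    f = refl
sumTo-sucˡ (suc m) f =
  trans (cong (ℤ._+ f (suc (suc m))) (sumTo-sucˡ m f)) (ℤP.+-assoc (f 0) _ _)

sumTo-reverse : ∀ m (f : ℕ → ℤ) → sumTo m f ≡ sumTo m (λ k → f (m ∸ k))
sumTo-reverse zero    f = refl
sumTo-reverse (suc m) f = begin
  sumTo m f ℤ.+ f (suc m)                         ≡⟨ cong (ℤ._+ f (suc m)) (sumTo-reverse m f) ⟩
  sumTo m (λ k → f (m ∸ k)) ℤ.+ f (suc m)         ≡⟨ ℤP.+-comm _ (f (suc m)) ⟩
  f (suc m) ℤ.+ sumTo m (λ k → f (m ∸ k))         ≡⟨ sumTo-sucˡ m (λ k → f (suc m ∸ k)) ⟨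
  sumTo (suc m) (λ k → f (suc m ∸ k))             ∎
  where open ≡-Reasoning

sumTo-minus : ∀ m (f g : ℕ → ℤ) → sumTo m (λ k → f k ℤ.- g k) ≡ sumTo m f ℤ.- sumTo m g
sumTo-minus zero    f g = refl
sumTo-minus (suc m) f g =
  trans (cong (ℤ._+ (f (suc m) ℤ.- g (suc m))) (sumTo-minus m f g))
        ([i-j]+[k-l]≡[i+k]-[j+l] (sumTo m f) (sumTo m g) (f (suc m)) (g (suc m)))

sumTo-vanishing-tail : ∀ {n m} (h : ℕ → ℤ) → (∀ j → n < j → h j ≡ + 0) →
                       n ≤ m → sumTo m h ≡ sumTo n h
sumTo-vanishing-tail {n} h tail n≤m = go (ℕP.≤⇒≤′ n≤m)
  where
  go : ∀ {m} → n ≤′ m → sumTo m h ≡ sumTo n h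
  go ≤′-refl            = refl
  go (≤′-step {m} n≤′m) =
    trans (cong₂ ℤ._+_ (go n≤′m) (tail (suc m) (s≤s (ℕP.≤′⇒≤ n≤′m)))) (ℤP.+-identityʳ _)

shift-suc-suc : ∀ k (s : Series) m → shift (suc k) s (suc m) ≡ shift k s m
shift-suc-suc zero    s m = refl
shift-suc-suc (suc k) s m = refl

shift-≤ : ∀ {k m} (s : Series) → k ≤ m → shift k s m ≡ s (m ∸ k)
shift-≤ s z≤n                 = refl
shift-≤ s (s≤s {k} {m} k≤m) = trans (shift-suc-suc k s m) (shift-≤ s k≤m)

shift-> : ∀ {k m} (s : Series) → m < k → shift k s m ≡ + 0
shift-> {suc k} {zero}  s m<k       = refl
shift-> {suc k} {suc m} s (s≤s m<k) = trans (shift-suc-suc k s m) (shift-> s m<k)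

shift-causal : ∀ k m {s t : Series} → (∀ i → i ≤ m → s i ≡ t i) → shift k s m ≡ shift k t m
shift-causal k m {s} {t} eq with k ≤? m
... | yes k≤m = trans (shift-≤ s k≤m) (trans (eq (m ∸ k) (ℕP.m∸n≤m m k)) (sym (shift-≤ t k≤m)))
... | no  k≰m = trans (shift-> s (ℕP.≰⇒> k≰m)) (sym (shift-> t (ℕP.≰⇒> k≰m)))

shift-strictly-causal : ∀ {k} m {s t : Series} → 1 ≤ k → (∀ i → i < m → s i ≡ t i) →
                        shift k s m ≡ shift k t m
shift-strictly-causal {suc k} zero    _ _  = refl
shift-strictly-causal {suc k} (suc m) {s} {t} _ eq =
  trans (shift-suc-suc k s m)
        (trans (shift-causal k m (λ i i≤m → eq i (s≤s i≤m))) (sym (shift-suc-suc k t m)))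

⊛-congˡ : ∀ {a a' : Series} (b : Series) → a ≗ a' → a ⊛ b ≗ a' ⊛ b
⊛-congˡ b eq m = sumTo-cong m (λ k _ → cong (ℤ._* b (m ∸ k)) (eq k))

⊛-congʳ : ∀ (a : Series) {b b' : Series} → b ≗ b' → a ⊛ b ≗ a ⊛ b'
⊛-congʳ a eq m = sumTo-cong m (λ k _ → cong (a k ℤ.*_) (eq (m ∸ k)))

⊛-comm : ∀ (a b : Series) → a ⊛ b ≗ b ⊛ a
⊛-comm a b m =
  trans (sumTo-reverse m (λ k → a k ℤ.* b (m ∸ k)))
        (sumTo-cong m (λ k k≤m → trans (cong (λ i → a (m ∸ k) ℤ.* b i) (ℕP.m∸[m∸n]≡n k≤m))
                                       (ℤP.*-comm (a (m ∸ k)) (b k))))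

⊛-identityˡ : ∀ (s : Series) → one ⊛ s ≗ s
⊛-identityˡ s m =
  trans (sumTo-vanishing-tail {m = m} (λ k → one k ℤ.* s (m ∸ k)) one-vanishes z≤n)
        (ℤP.*-identityˡ (s m))
  where
  one-vanishes : ∀ k → 0 < k → one k ℤ.* s (m ∸ k) ≡ + 0
  one-vanishes (suc k) _ = refl

⊛-identityʳ : ∀ (s : Series) → s ⊛ one ≗ s
⊛-identityʳ s m = trans (⊛-comm s one m) (⊛-identityˡ s m)

⊛-distribʳ-minus : ∀ (a c b : Series) → (λ i → a i ℤ.- c i) ⊛ b ≗ (λ m → (a ⊛ b) m ℤ.- (c ⊛ b) m)
⊛-distribʳ-minus a c b m =
  trans (sumTo-cong m (λ k _ → [i-j]*k≡i*k-j*k (a k) (c k) (b (m ∸ k))))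
        (sumTo-minus m (λ k → a k ℤ.* b (m ∸ k)) (λ k → c k ℤ.* b (m ∸ k)))

shift-⊛ : ∀ j (a b : Series) → shift j (a ⊛ b) ≗ shift j a ⊛ b
shift-⊛ zero    a b m       = refl
shift-⊛ (suc j) a b zero    = refl
shift-⊛ (suc j) a b (suc m) = begin
  shift (suc j) (a ⊛ b) (suc m)                                 ≡⟨ shift-suc-suc j (a ⊛ b) m ⟩
  shift j (a ⊛ b) m                                             ≡⟨ shift-⊛ j a b m ⟩
  sumTo m (λ k → shift j a k ℤ.* b (m ∸ k))                     ≡⟨ sumTo-cong m shifted-terms ⟨
  sumTo m (λ k → shift (suc j) a (suc k) ℤ.* b (m ∸ k))         ≡⟨ ℤP.+-identityˡ _ ⟨
  + 0 ℤ.+ sumTo m (λ k → shift (suc j) a (suc k) ℤ.* b (m ∸ k)) ≡⟨ sumTo-sucˡ m _ ⟨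
  (shift (suc j) a ⊛ b) (suc m)                                 ∎
  where
  open ≡-Reasoning
  shifted-terms : ∀ k → k ≤ m → shift (suc j) a (suc k) ℤ.* b (m ∸ k) ≡ shift j a k ℤ.* b (m ∸ k)
  shifted-terms k _ = cong (ℤ._* b (m ∸ k)) (shift-suc-suc j a k)

-- A multiplier is an operator s ↦ g ⊛ s, characterised without reference to g.  Causality
-- replaces function extensionality: it makes multipliers respect ≗ and lets them be
-- truncated degree by degree.
record Multiplier (F : Series → Series) : Set where
  field
    causal   : ∀ {s t : Series} m → (∀ i → i ≤ m → s i ≡ t i) → F s m ≡ F t m
    ⊛-linear : ∀ (a b : Series) → F (a ⊛ b) ≗ F a ⊛ b

  resp-≗ : ∀ {s t : Series} → s ≗ t → F s ≗ F t
  resp-≗ eq m = causal m (λ i _ → eq i)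

  ≗-image-of-one-⊛ : ∀ s → F s ≗ F one ⊛ s
  ≗-image-of-one-⊛ s = ≗.trans (resp-≗ (≗.sym (⊛-identityˡ s))) (⊛-linear one s)

open Multiplier

multiplier-commute : ∀ {F G} → Multiplier F → Multiplier G → ∀ s → F (G s) ≗ G (F s)
multiplier-commute {F} {G} mF mG s = begin
  F (G s)               ≈⟨ composite mF mG ⟩
  (F one ⊛ G one) ⊛ s   ≈⟨ ⊛-congˡ s (⊛-comm (F one) (G one)) ⟩
  (G one ⊛ F one) ⊛ s   ≈⟨ composite mG mF ⟨
  G (F s)               ∎
  where
  open ≗-Reasoning
  composite : ∀ {F G} → Multiplier F → Multiplier G → F (G s) ≗ (F one ⊛ G one) ⊛ s
  composite {F} {G} mF mG = begin
    F (G s)               ≈⟨ resp-≗ mF (≗-image-of-one-⊛ mG s) ⟩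
    F (G one ⊛ s)         ≈⟨ ⊛-linear mF (G one) s ⟩
    F (G one) ⊛ s         ≈⟨ ⊛-congˡ s (≗-image-of-one-⊛ mF (G one)) ⟩
    (F one ⊛ G one) ⊛ s   ∎

id-multiplier : Multiplier (λ s → s)
causal   id-multiplier m eq = eq m ℕP.≤-refl
⊛-linear id-multiplier a b m = refl

∘-multiplier : ∀ {F G} → Multiplier F → Multiplier G → Multiplier (λ s → F (G s))
causal   (∘-multiplier mF mG) m eq =
  causal mF m (λ i i≤m → causal mG i (λ j j≤i → eq j (ℕP.≤-trans j≤i i≤m)))
⊛-linear (∘-multiplier {F} {G} mF mG) a b =
  ≗.trans (resp-≗ mF (⊛-linear mG a b)) (⊛-linear mF (G a) b)

shift-multiplier : ∀ k → Multiplier (shift k)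
causal   (shift-multiplier k) m = shift-causal k m
⊛-linear (shift-multiplier k) = shift-⊛ k

mulFactor-multiplier : ∀ k → Multiplier (mulFactor k)
causal   (mulFactor-multiplier k) m eq = cong₂ ℤ._-_ (eq m ℕP.≤-refl) (shift-causal k m eq)
⊛-linear (mulFactor-multiplier k) a b m =
  trans (cong (λ i → (a ⊛ b) m ℤ.- i) (shift-⊛ k a b m))
        (sym (⊛-distribʳ-minus a (shift k a) b m))

ActsTriviallyBelow : (ℕ → Series → Series) → Set
ActsTriviallyBelow op = ∀ k (s : Series) m → m < k → op k s m ≡ s m

mulFactor-below : ActsTriviallyBelow mulFactor
mulFactor-below k s m m<k =
  trans (cong (λ i → s m ℤ.- i) (shift-> s m<k)) (ℤP.+-identityʳ (s m))

-- Since 1 ≤ k, the coefficient s i is determined by mulFactor k s i and the s j with j < i.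
mulFactor-injective : ∀ {k} {x y : Series} → 1 ≤ k → mulFactor k x ≗ mulFactor k y → x ≗ y
mulFactor-injective {k} {x} {y} 1≤k eq = <-rec (λ i → x i ≡ y i) step
  where
  open ≡-Reasoning
  step : ∀ i → (∀ {j} → j < i → x j ≡ y j) → x i ≡ y i
  step i below = begin
    x i                                  ≡⟨ [i-j]+j≡i (x i) (shift k x i) ⟨
    mulFactor k x i ℤ.+ shift k x i
      ≡⟨ cong₂ ℤ._+_ (eq i) (shift-strictly-causal i 1≤k (λ j → below)) ⟩
    mulFactor k y i ℤ.+ shift k y i      ≡⟨ [i-j]+j≡i (y i) (shift k y i) ⟩
    y i                                  ∎

-- Division by 1 - q^k

shift-+ : ∀ {k m} i (s : Series) → k ≤ m → shift (k + i) s m ≡ shift i s (m ∸ k)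
shift-+ i s z≤n                 = refl
shift-+ i s (s≤s {k} {m} k≤m) = trans (shift-suc-suc (k + i) s m) (shift-+ i s k≤m)

shift-*-zero : ∀ k (s : Series) m → shift (k * 0) s m ≡ s m
shift-*-zero k s m = cong (λ i → shift i s m) (ℕP.*-zeroʳ k)

divFactor-below : ActsTriviallyBelow divFactor
divFactor-below k s m m<k =
  trans (sumTo-vanishing-tail {m = m} (λ j → shift (k * j) s m) higher-vanish z≤n)
        (shift-*-zero k s m)
  where
  higher-vanish : ∀ j → 0 < j → shift (k * j) s m ≡ + 0
  higher-vanish (suc j) _ = shift-> s (ℕP.<-≤-trans m<k (ℕP.m≤m*n k (suc j)))

divFactor-above : ∀ {k m} (s : Series) → 1 ≤ k → k ≤ m →
                  divFactor k s m ≡ s m ℤ.+ divFactor k s (m ∸ k)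
divFactor-above {suc _} {zero}  s _   ()
divFactor-above {k}     {suc m} s 1≤k k≤m = begin
  divFactor k s (suc m)                                            ≡⟨ sumTo-sucˡ m _ ⟩
  shift (k * 0) s (suc m) ℤ.+ sumTo m (λ j → shift (k * suc j) s (suc m))
    ≡⟨ cong₂ ℤ._+_ (shift-*-zero k s (suc m)) (sumTo-cong m (λ j _ → peel j)) ⟩
  s (suc m) ℤ.+ sumTo m (λ j → shift (k * j) s (suc m ∸ k))
    ≡⟨ cong (λ i → s (suc m) ℤ.+ i)
            (sumTo-vanishing-tail _ higher-vanish (ℕP.∸-monoʳ-≤ (suc m) 1≤k)) ⟩
  s (suc m) ℤ.+ divFactor k s (suc m ∸ k)                         ∎
  where
  open ≡-Reasoning
  peel : ∀ j → shift (k * suc j) s (suc m) ≡ shift (k * j) s (suc m ∸ k)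
  peel j = trans (cong (λ i → shift i s (suc m)) (ℕP.*-suc k j)) (shift-+ (k * j) s k≤m)
  higher-vanish : ∀ j → suc m ∸ k < j → shift (k * j) s (suc m ∸ k) ≡ + 0
  higher-vanish j lt = shift-> s (ℕP.<-≤-trans lt (ℕP.m≤n*m j k {{>-nonZero 1≤k}}))

divFactor-unfold : ∀ {k} (s : Series) m → 1 ≤ k →
                   divFactor k s m ≡ s m ℤ.+ shift k (divFactor k s) m
divFactor-unfold {k} s m 1≤k with k ≤? m
... | yes k≤m =
  trans (divFactor-above s 1≤k k≤m) (cong (λ i → s m ℤ.+ i) (sym (shift-≤ (divFactor k s) k≤m)))
... | no  k≰m =
  trans (divFactor-below k s m (ℕP.≰⇒> k≰m))
        (trans (sym (ℤP.+-identityʳ (s m)))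
               (cong (λ i → s m ℤ.+ i) (sym (shift-> (divFactor k s) (ℕP.≰⇒> k≰m)))))

mulFactor-divFactor : ∀ {k} (s : Series) → 1 ≤ k → mulFactor k (divFactor k s) ≗ s
mulFactor-divFactor {k} s 1≤k m =
  trans (cong (ℤ._- shift k (divFactor k s) m) (divFactor-unfold s m 1≤k))
        ([i+j]-j≡i (s m) (shift k (divFactor k s) m))

divFactor-multiplier : ∀ {k} → 1 ≤ k → Multiplier (divFactor k)
causal   (divFactor-multiplier {k} _) m eq =
  sumTo-cong m (λ j _ → shift-causal (k * j) m eq)
⊛-linear (divFactor-multiplier {k} 1≤k) a b = mulFactor-injective 1≤k (begin
  mulFactor k (divFactor k (a ⊛ b))      ≈⟨ mulFactor-divFactor (a ⊛ b) 1≤k ⟩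
  a ⊛ b                                  ≈⟨ ⊛-congˡ b (mulFactor-divFactor a 1≤k) ⟨
  mulFactor k (divFactor k a) ⊛ b        ≈⟨ ⊛-linear (mulFactor-multiplier k) (divFactor k a) b ⟨
  mulFactor k (divFactor k a ⊛ b)        ∎)
  where open ≗-Reasoning

-- The infinite products f_r

prodUpTo-multiplier : ∀ {op r} → (∀ k → 1 ≤ k → Multiplier (op k)) → 1 ≤ r →
                      ∀ N → Multiplier (prodUpTo op r N)
prodUpTo-multiplier         mop 1≤r zero    = id-multiplier
prodUpTo-multiplier {r = r} mop 1≤r (suc N) =
  ∘-multiplier (mop (r * suc N) (ℕP.*-mono-≤ 1≤r (s≤s z≤n))) (prodUpTo-multiplier mop 1≤r N)

prodUpTo-stable : ∀ {op r M N} → ActsTriviallyBelow op → M ≤ N → ∀ (s : Series) m →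
                  m < r * suc M → prodUpTo op r N s m ≡ prodUpTo op r M s m
prodUpTo-stable {op} {r} {M} trivial M≤N s m m<r[1+M] = go (ℕP.≤⇒≤′ M≤N)
  where
  go : ∀ {N} → M ≤′ N → prodUpTo op r N s m ≡ prodUpTo op r M s m
  go ≤′-refl            = refl
  go (≤′-step {N} M≤′N) =
    trans (trivial (r * suc N) _ m
                   (ℕP.<-≤-trans m<r[1+M] (ℕP.*-monoʳ-≤ r (s≤s (ℕP.≤′⇒≤ M≤′N)))))
          (go M≤′N)

diagonal : (ℕ → Series → Series) → Series → Series
diagonal P s m = P m s m

diagonal-multiplier : ∀ {P} → (∀ N → Multiplier (P N)) →
                      (∀ s m N → m ≤ N → P N s m ≡ P m s m) → Multiplier (diagonal P)
causal   (diagonal-multiplier mP stable) m eq = causal (mP m) m eq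
⊛-linear (diagonal-multiplier {P} mP stable) a b m =
  trans (⊛-linear (mP m) a b m)
        (sumTo-cong m (λ k k≤m → cong (ℤ._* b (m ∸ k)) (stable a k m k≤m)))

prodUpTo-diagonal-stable : ∀ {op r} → ActsTriviallyBelow op → 1 ≤ r →
                           ∀ s m N → m ≤ N → prodUpTo op r N s m ≡ prodUpTo op r m s m
prodUpTo-diagonal-stable trivial 1≤r s m N m≤N =
  prodUpTo-stable trivial m≤N s m (ℕP.m≤n*m (suc m) _ {{>-nonZero 1≤r}})

fMul-multiplier : ∀ {r} → 1 ≤ r → Multiplier (fMul r)
fMul-multiplier 1≤r =
  diagonal-multiplier (prodUpTo-multiplier (λ k _ → mulFactor-multiplier k) 1≤r)
                      (prodUpTo-diagonal-stable mulFactor-below 1≤r)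

fDiv-multiplier : ∀ {r} → 1 ≤ r → Multiplier (fDiv r)
fDiv-multiplier 1≤r =
  diagonal-multiplier (prodUpTo-multiplier (λ k → divFactor-multiplier) 1≤r)
                      (prodUpTo-diagonal-stable divFactor-below 1≤r)

prodUpTo-mulFactor-divFactor : ∀ {r} → 1 ≤ r → ∀ N (s : Series) →
                               prodUpTo mulFactor r N (prodUpTo divFactor r N s) ≗ s
prodUpTo-mulFactor-divFactor         1≤r zero    s m = refl
prodUpTo-mulFactor-divFactor {r} 1≤r (suc N) s =
  begin
    mulFactor k (prodUpTo mulFactor r N (divFactor k (prodUpTo divFactor r N s)))
  ≈⟨ resp-≗ (mulFactor-multiplier k)
             (multiplier-commute earlier-factors (divFactor-multiplier 1≤k) _) ⟩
    mulFactor k (divFactor k (prodUpTo mulFactor r N (prodUpTo divFactor r N s)))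
  ≈⟨ mulFactor-divFactor _ 1≤k ⟩
    prodUpTo mulFactor r N (prodUpTo divFactor r N s)
  ≈⟨ prodUpTo-mulFactor-divFactor 1≤r N s ⟩
    s
  ∎
  where
  open ≗-Reasoning
  k = r * suc N
  1≤k : 1 ≤ k
  1≤k = ℕP.*-mono-≤ 1≤r (s≤s z≤n)
  earlier-factors : Multiplier (prodUpTo mulFactor r N)
  earlier-factors = prodUpTo-multiplier (λ k _ → mulFactor-multiplier k) 1≤r N

fMul-fDiv : ∀ {r} → 1 ≤ r → ∀ (s : Series) → fMul r (fDiv r s) ≗ s
fMul-fDiv {r} 1≤r s m =
  trans (causal (prodUpTo-multiplier (λ k _ → mulFactor-multiplier k) 1≤r m) m
                (λ i i≤m → sym (prodUpTo-diagonal-stable divFactor-below 1≤r s i m i≤m)))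
        (prodUpTo-mulFactor-divFactor 1≤r m s m)

fDiv-fMul : ∀ {r} → 1 ≤ r → ∀ (s : Series) → fDiv r (fMul r s) ≗ s
fDiv-fMul 1≤r s =
  ≗.trans (multiplier-commute (fDiv-multiplier 1≤r) (fMul-multiplier 1≤r) s) (fMul-fDiv 1≤r s)

-- The operator U₅

U5-cong : ∀ {s t : Series} → s ≗ t → U5 s ≗ U5 t
U5-cong eq n = eq (5 * n)

U5-shift : ∀ k (T : Series) → U5 (shift (5 * k) T) ≗ shift k (U5 T)
U5-shift k T n with k ≤? n
... | yes k≤n = begin
  shift (5 * k) T (5 * n)   ≡⟨ shift-≤ T (ℕP.*-monoʳ-≤ 5 k≤n) ⟩
  T (5 * n ∸ 5 * k)         ≡⟨ cong T (ℕP.*-distribˡ-∸ 5 n k) ⟨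
  U5 T (n ∸ k)              ≡⟨ shift-≤ (U5 T) k≤n ⟨
  shift k (U5 T) n          ∎
  where open ≡-Reasoning
... | no  k≰n =
  trans (shift-> T (ℕP.*-monoʳ-< 5 (ℕP.≰⇒> k≰n))) (sym (shift-> (U5 T) (ℕP.≰⇒> k≰n)))

U5-prodUpTo-mulFactor : ∀ r N (T : Series) →
                        U5 (prodUpTo mulFactor (5 * r) N T) ≗ prodUpTo mulFactor r N (U5 T)
U5-prodUpTo-mulFactor r zero    T n = refl
U5-prodUpTo-mulFactor r (suc N) T n =
  trans (cong (λ k → mulFactor k T′ (5 * n)) (ℕP.*-assoc 5 r (suc N)))
        (cong₂ ℤ._-_ (U5-prodUpTo-mulFactor r N T n)
                     (trans (U5-shift (r * suc N) T′ n)
                            (shift-causal (r * suc N) n (λ i _ → U5-prodUpTo-mulFactor r N T i))))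
  where
  T′ = prodUpTo mulFactor (5 * r) N T

U5-fMul : ∀ {r} → 1 ≤ r → ∀ (T : Series) → U5 (fMul (5 * r) T) ≗ fMul r (U5 T)
U5-fMul {r} 1≤r T n =
  trans (prodUpTo-stable mulFactor-below (ℕP.m≤n*m n 5) T (5 * n) 5n<5r[1+n])
        (U5-prodUpTo-mulFactor r n T n)
  where
  5n<5r[1+n] : 5 * n < 5 * r * suc n
  5n<5r[1+n] = subst (5 * n <_) (sym (ℕP.*-assoc 5 r (suc n)))
                     (ℕP.*-monoʳ-< 5 (ℕP.<-≤-trans (ℕP.n<1+n n)
                                                  (ℕP.m≤n*m (suc n) r {{>-nonZero 1≤r}})))

U5-shift-1 : ∀ (T : Series) → U5 (shift 1 T) ≗ shift 1 (λ n → T (5 * n + 4))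
U5-shift-1 T zero    = refl
U5-shift-1 T (suc n) = cong T (index n)
  where
  index : ∀ n → n + 4 * suc n ≡ 5 * n + 4
  index = ℕ-Solver.solve-∀

f₁f₂² f₅f₁₀² f₂₅f₅₀² f₁f₂²⁻¹ : Series → Series
f₁f₂²   s = fMul 1 (fMul 2 (fMul 2 s))
f₅f₁₀²  s = fMul 5 (fMul 10 (fMul 10 s))
f₂₅f₅₀² s = fMul 25 (fMul 50 (fMul 50 s))
f₁f₂²⁻¹ s = fDiv 1 (fDiv 2 (fDiv 2 s))

fMul-triple-multiplier : ∀ {r r′} → 1 ≤ r → 1 ≤ r′ →
                         Multiplier (λ s → fMul r (fMul r′ (fMul r′ s)))
fMul-triple-multiplier 1≤r 1≤r′ =
  ∘-multiplier (fMul-multiplier 1≤r) (∘-multiplier (fMul-multiplier 1≤r′) (fMul-multiplier 1≤r′))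

f₁f₂²⁻¹-multiplier : Multiplier f₁f₂²⁻¹
f₁f₂²⁻¹-multiplier =
  ∘-multiplier (fDiv-multiplier z<s) (∘-multiplier (fDiv-multiplier z<s) (fDiv-multiplier z<s))

f₁f₂²⁻¹-f₁f₂² : ∀ (S : Series) → f₁f₂²⁻¹ (f₁f₂² S) ≗ S
f₁f₂²⁻¹-f₁f₂² S = begin
  fDiv 1 (fDiv 2 (fDiv 2 (fMul 1 (fMul 2 (fMul 2 S)))))
    ≈⟨ resp-≗ (fDiv-multiplier z<s) (multiplier-commute fDiv₂² (fMul-multiplier z<s) _) ⟩
  fDiv 1 (fMul 1 (fDiv 2 (fDiv 2 (fMul 2 (fMul 2 S)))))   ≈⟨ fDiv-fMul z<s _ ⟩
  fDiv 2 (fDiv 2 (fMul 2 (fMul 2 S)))                     ≈⟨ resp-≗ (fDiv-multiplier z<s) (fDiv-fMul z<s _) ⟩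
  fDiv 2 (fMul 2 S)                                       ≈⟨ fDiv-fMul z<s S ⟩
  S                                                       ∎
  where
  open ≗-Reasoning
  fDiv₂² : Multiplier (λ s → fDiv 2 (fDiv 2 s))
  fDiv₂² = ∘-multiplier (fDiv-multiplier z<s) (fDiv-multiplier z<s)

U5-fMul-triple : ∀ {r r′} → 1 ≤ r → 1 ≤ r′ → ∀ (R : Series) →
                 U5 (fMul (5 * r) (fMul (5 * r′) (fMul (5 * r′) R))) ≗ fMul r (fMul r′ (fMul r′ (U5 R)))
U5-fMul-triple 1≤r 1≤r′ R =
  ≗.trans (U5-fMul 1≤r _)
          (resp-≗ (fMul-multiplier 1≤r)
                  (≗.trans (U5-fMul 1≤r′ _) (resp-≗ (fMul-multiplier 1≤r′) (U5-fMul 1≤r′ R))))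

U5²-q⁵f₂₅f₅₀² : ∀ (R : Series) →
               U5 (U5 (shift 5 (f₂₅f₅₀² R))) ≗ shift 1 (f₁f₂² (λ n → R (25 * n + 20)))
U5²-q⁵f₂₅f₅₀² R = begin
  U5 (U5 (shift 5 (f₂₅f₅₀² R)))     ≈⟨ U5-cong (U5-shift 1 (f₂₅f₅₀² R)) ⟩
  U5 (shift 1 (U5 (f₂₅f₅₀² R)))     ≈⟨ U5-cong (resp-≗ (shift-multiplier 1) (U5-fMul-triple z<s z<s R)) ⟩
  U5 (shift 1 (f₅f₁₀² (U5 R)))
    ≈⟨ U5-cong (multiplier-commute (shift-multiplier 1) (fMul-triple-multiplier z<s z<s) _) ⟩
  U5 (f₅f₁₀² (shift 1 (U5 R)))      ≈⟨ U5-fMul-triple z<s z<s _ ⟩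
  f₁f₂² (U5 (shift 1 (U5 R)))       ≈⟨ resp-≗ f₁f₂²-multiplier (U5-shift-1 (U5 R)) ⟩
  f₁f₂² (shift 1 (λ n → R (5 * (5 * n + 4))))
    ≈⟨ resp-≗ f₁f₂²-multiplier (resp-≗ (shift-multiplier 1) (λ n → cong R (index n))) ⟩
  f₁f₂² (shift 1 (λ n → R (25 * n + 20)))
    ≈⟨ multiplier-commute f₁f₂²-multiplier (shift-multiplier 1) _ ⟩
  shift 1 (f₁f₂² (λ n → R (25 * n + 20))) ∎
  where
  open ≗-Reasoning
  f₁f₂²-multiplier : Multiplier f₁f₂²
  f₁f₂²-multiplier = fMul-triple-multiplier z<s z<s
  index : ∀ n → 5 * (5 * n + 4) ≡ 25 * n + 20
  index = ℕ-Solver.solve-∀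

-- Φ = q⁵ f₂₅f₅₀² (f₁f₂²)⁻¹ one, and the inverse cancels against the factor f₁f₂².
Φ-⊛-qf₁f₂² : ∀ (S : Series) → Φ ⊛ shift 1 (f₁f₂² S) ≗ shift 5 (f₂₅f₅₀² (shift 1 S))
Φ-⊛-qf₁f₂² S = begin
  C one ⊛ X                       ≈⟨ ⊛-linear C-multiplier one X ⟨
  C (one ⊛ X)                     ≈⟨ resp-≗ C-multiplier (⊛-identityˡ X) ⟩
  shift 5 (f₂₅f₅₀² (f₁f₂²⁻¹ X))
    ≈⟨ resp-≗ q⁵f₂₅f₅₀²-multiplier (multiplier-commute f₁f₂²⁻¹-multiplier (shift-multiplier 1) _) ⟩
  shift 5 (f₂₅f₅₀² (shift 1 (f₁f₂²⁻¹ (f₁f₂² S))))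
    ≈⟨ resp-≗ q⁵f₂₅f₅₀²-multiplier (resp-≗ (shift-multiplier 1) (f₁f₂²⁻¹-f₁f₂² S)) ⟩
  shift 5 (f₂₅f₅₀² (shift 1 S))   ∎
  where
  open ≗-Reasoning
  X = shift 1 (f₁f₂² S)
  q⁵f₂₅f₅₀²-multiplier : Multiplier (λ s → shift 5 (f₂₅f₅₀² s))
  q⁵f₂₅f₅₀²-multiplier = ∘-multiplier (shift-multiplier 5) (fMul-triple-multiplier z<s z<s)
  C : Series → Series
  C s = shift 5 (f₂₅f₅₀² (f₁f₂²⁻¹ s))
  C-multiplier : Multiplier C
  C-multiplier = ∘-multiplier q⁵f₂₅f₅₀²-multiplier f₁f₂²⁻¹-multiplier

isEven-suc-suc : ∀ k → isEven (suc (suc k)) ≡ isEven k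
isEven-suc-suc k with isEven k
... | true  = refl
... | false = refl

isEven-double : ∀ a → isEven (2 * a) ≡ true
isEven-double zero    = refl
isEven-double (suc a) =
  trans (cong isEven (ℕP.*-suc 2 a)) (trans (isEven-suc-suc (2 * a)) (isEven-double a))

L-suc-suc : ∀ k → isEven k ≡ true → L (suc (suc k)) ≗ U5 (U5 (Φ ⊛ L k))
L-suc-suc k even n rewrite even = refl

L-double-step : ∀ a → L (2 * suc a) ≗ U5 (U5 (Φ ⊛ L (2 * a)))
L-double-step a n =
  trans (cong (λ k → L k n) (ℕP.*-suc 2 a)) (L-suc-suc (2 * a) (isEven-double a) n)

geometric25 : ℕ → ℕ
geometric25 zero    = 0
geometric25 (suc b) = 25 * geometric25 b + 1

25^≡1+24*geometric25 : ∀ b → 25 ^ b ≡ 1 + 24 * geometric25 b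
25^≡1+24*geometric25 zero    = refl
25^≡1+24*geometric25 (suc b) =
  trans (cong (25 *_) (25^≡1+24*geometric25 b)) (lemma (geometric25 b))
  where
  lemma : ∀ g → 25 * (1 + 24 * g) ≡ 1 + 24 * (25 * g + 1)
  lemma = ℕ-Solver.solve-∀

γ-suc : ∀ b → γ (suc b) ≡ 20 + 475 * geometric25 b
γ-suc b = cong (λ x → 20 + x) (begin
  475 * (25 ^ b ∸ 1) / 24               ≡⟨ cong (λ x → 475 * (x ∸ 1) / 24) (25^≡1+24*geometric25 b) ⟩
  475 * (24 * geometric25 b) / 24       ≡⟨ cong (_/ 24) (lemma (geometric25 b)) ⟩
  475 * geometric25 b * 24 / 24         ≡⟨ m*n/n≡m (475 * geometric25 b) 24 ⟩
  475 * geometric25 b                   ∎)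
  where
  open ≡-Reasoning
  lemma : ∀ g → 475 * (24 * g) ≡ 475 * g * 24
  lemma = ℕ-Solver.solve-∀

a₃-progression : ℕ → Series
a₃-progression α n = a3 (5 ^ (2 * α) * n + γ α)

-- γ (α + 1) = γ α + 19 · 25^α, so the progression of index α + 1 is the subprogression
-- 25 n + 19 of the one of index α.
a₃-progression-step : ∀ α n → a₃-progression (suc α) (25 * n + 19) ≡ a₃-progression (suc (suc α)) n
a₃-progression-step α n = cong a3 (begin
  5 ^ (2 * suc α) * (25 * n + 19) + γ (suc α)
    ≡⟨ cong₂ (λ x y → x * (25 * n + 19) + y) (5^[2*suc]≡ α) (γ-suc α) ⟩
  25 * (1 + 24 * g) * (25 * n + 19) + (20 + 475 * g)
    ≡⟨ lemma g n ⟩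
  25 * (1 + 24 * (25 * g + 1)) * n + (20 + 475 * (25 * g + 1))
    ≡⟨ cong₂ (λ x y → x * n + y) (5^[2*suc]≡ (suc α)) (γ-suc (suc α)) ⟨
  5 ^ (2 * suc (suc α)) * n + γ (suc (suc α)) ∎)
  where
  open ≡-Reasoning
  g = geometric25 α
  5^[2*suc]≡ : ∀ b → 5 ^ (2 * suc b) ≡ 25 * (1 + 24 * geometric25 b)
  5^[2*suc]≡ b = trans (sym (ℕP.^-*-assoc 5 2 (suc b))) (cong (25 *_) (25^≡1+24*geometric25 b))
  lemma : ∀ g n → 25 * (1 + 24 * g) * (25 * n + 19) + (20 + 475 * g)
                ≡ 25 * (1 + 24 * (25 * g + 1)) * n + (20 + 475 * (25 * g + 1))
  lemma = ℕ-Solver.solve-∀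

L-even : ∀ α → L (2 * suc α) ≗ shift 1 (f₁f₂² (a₃-progression (suc α)))
L-even zero = begin
  L 2                  ≈⟨ L-double-step 0 ⟩
  U5 (U5 (Φ ⊛ one))    ≈⟨ U5-cong (U5-cong (⊛-identityʳ Φ)) ⟩
  U5 (U5 Φ)            ≈⟨ U5²-q⁵f₂₅f₅₀² a3 ⟩
  shift 1 (f₁f₂² (a₃-progression 1)) ∎
  where open ≗-Reasoning
L-even (suc α) = begin
  L (2 * suc (suc α))                                  ≈⟨ L-double-step (suc α) ⟩
  U5 (U5 (Φ ⊛ L (2 * suc α)))                          ≈⟨ U5-cong (U5-cong (⊛-congʳ Φ (L-even α))) ⟩
  U5 (U5 (Φ ⊛ shift 1 (f₁f₂² S)))                      ≈⟨ U5-cong (U5-cong (Φ-⊛-qf₁f₂² S)) ⟩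
  U5 (U5 (shift 5 (f₂₅f₅₀² (shift 1 S))))              ≈⟨ U5²-q⁵f₂₅f₅₀² (shift 1 S) ⟩
  shift 1 (f₁f₂² (λ n → shift 1 S (25 * n + 20)))
    ≈⟨ resp-≗ (∘-multiplier (shift-multiplier 1) (fMul-triple-multiplier z<s z<s)) next-progression ⟩
  shift 1 (f₁f₂² (a₃-progression (suc (suc α))))       ∎
  where
  open ≗-Reasoning
  S = a₃-progression (suc α)
  next-progression : (λ n → shift 1 S (25 * n + 20)) ≗ a₃-progression (suc (suc α))
  next-progression n =
    trans (shift-≤ S (ℕP.≤-trans z<s (ℕP.m≤n+m 20 (25 * n))))
          (trans (cong S (ℕP.+-∸-assoc (25 * n) z<s)) (a₃-progression-step α n))

lemma4p1 : (α : ℕ) → 1 ≤ α → (m : ℕ) →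
    L (2 * α) m ≡ shift 1 (fMul 1 (fMul 2 (fMul 2 (λ n → a3 (5 ^ (2 * α) * n + γ α))))) m
lemma4p1 (suc α) _ = L-even α
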